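{- Let $L$ be either of the sequent calculi $\mathrm{lTS4}$ or $\mathrm{gTS4}$ defined in the context. For every sequent $S$, if $S$ is provable in $\mathrm{GS4}$ without using the rule (cut), then $S$ is provable in $L$ without using the rule (cut).
   Context: Formulas are built from countably many propositional variables using the binary connectives $\wedge,\vee,\to$ and the unary connectives $\neg,\Box,\Diamond$. Letters $\Gamma,\Delta$ (possibly with subscripts) denote finite, possibly empty, sets of formulas; a sequent is an expression $\Gamma\Rightarrow\Delta$; a comma denotes union. For a word $w$ over $\{\neg,\Box,\Diamond\}$, $w\Gamma=\{w\gamma:\gamma\in\Gamma\}$. A rule "$S_1;\dots;S_n\,/\,S$" has premises $S_1,\dots,S_n$ and conclusion $S$. The calculus lTS4. Initial sequents: for every propositional variable $p$: $p\Rightarrow p$, $\neg p\Rightarrow\neg p$, $\neg p,p\Rightarrow$, and $\Rightarrow\neg p,p$. Structural rules: (cut) $\Gamma\Rightarrow\alpha$; $\alpha,\Gamma\Rightarrow\Delta$ / $\Gamma\Rightarrow\Delta$. (we-left) $\Gamma\Rightarrow\Delta$ / $\alpha,\Gamma\Rightarrow\Delta$. (we-right) $\Gamma\Rightarrow\Delta$ / $\Gamma\Rightarrow\Delta,\alpha$. Non-twist logical rules: ($\wedge$left) $\alpha,\beta,\Gamma\Rightarrow\Delta$ / $\alpha\wedge\beta,\Gamma\Rightarrow\Delta$. ($\wedge$right) $\Gamma\Rightarrow\Delta,\alpha$; $\Gamma\Rightarrow\Delta,\beta$ / $\Gamma\Rightarrow\Delta,\alpha\wedge\beta$. ($\vee$left)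 $\alpha,\Gamma\Rightarrow\Delta$; $\beta,\Gamma\Rightarrow\Delta$ / $\alpha\vee\beta,\Gamma\Rightarrow\Delta$. ($\vee$right) $\Gamma\Rightarrow\Delta,\alpha,\beta$ / $\Gamma\Rightarrow\Delta,\alpha\vee\beta$. ($\to$left) $\Gamma\Rightarrow\Delta,\alpha$; $\beta,\Gamma\Rightarrow\Delta$ / $\alpha\to\beta,\Gamma\Rightarrow\Delta$. ($\to$right) $\alpha,\Gamma\Rightarrow\Delta,\beta$ / $\Gamma\Rightarrow\Delta,\alpha\to\beta$. ($\Box$left) $\alpha,\Gamma\Rightarrow\Delta$ / $\Box\alpha,\Gamma\Rightarrow\Delta$. ($\Box$right) $\Box\Gamma_1,\neg\Diamond\Gamma_2\Rightarrow\Diamond\Delta_1,\neg\Box\Delta_2,\alpha$ / $\Box\Gamma_1,\neg\Diamond\Gamma_2\Rightarrow\Diamond\Delta_1,\neg\Box\Delta_2,\Box\alpha$. ($\Diamond$left) $\alpha,\Box\Gamma_1,\neg\Diamond\Gamma_2\Rightarrow\Diamond\Delta_1,\neg\Box\Delta_2$ / $\Diamond\alpha,\Box\Gamma_1,\neg\Diamond\Gamma_2\Rightarrow\Diamond\Delta_1,\neg\Box\Delta_2$. ($\Diamond$right) $\Gamma\Rightarrow\Delta,\alpha$ / $\Gamma\Rightarrow\Delta,\Diamond\alpha$. Twist rules: ($\neg\neg$left$^t$) $\alpha,\Gamma\Rightarrow\Delta$ / $\neg\neg\alpha,\Gamma\Rightarrow\Delta$. ($\neg\neg$right$^t$) $\Gamma\Rightarrow\Delta,\alpha$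 / $\Gamma\Rightarrow\Delta,\neg\neg\alpha$. ($\neg\wedge$left$^t$) $\Gamma\Rightarrow\Delta,\alpha$; $\Gamma\Rightarrow\Delta,\beta$ / $\neg(\alpha\wedge\beta),\Gamma\Rightarrow\Delta$. ($\neg\wedge$right$^t$) $\alpha,\beta,\Gamma\Rightarrow\Delta$ / $\Gamma\Rightarrow\Delta,\neg(\alpha\wedge\beta)$. ($\neg\vee$left$^t$) $\Gamma\Rightarrow\Delta,\alpha,\beta$ / $\neg(\alpha\vee\beta),\Gamma\Rightarrow\Delta$. ($\neg\vee$right$^t$) $\alpha,\Gamma\Rightarrow\Delta$; $\beta,\Gamma\Rightarrow\Delta$ / $\Gamma\Rightarrow\Delta,\neg(\alpha\vee\beta)$. ($\neg\to$left$^t$) $\alpha,\Gamma\Rightarrow\Delta,\beta$ / $\neg(\alpha\to\beta),\Gamma\Rightarrow\Delta$. ($\neg\to$right$^t$) $\Gamma\Rightarrow\Delta,\alpha$; $\beta,\Gamma\Rightarrow\Delta$ / $\Gamma\Rightarrow\Delta,\neg(\alpha\to\beta)$. ($\neg\Box$left$^t$) $\Box\Gamma_1,\neg\Diamond\Gamma_2\Rightarrow\Diamond\Delta_1,\neg\Box\Delta_2,\alpha$ / $\neg\Box\alpha,\Box\Gamma_1,\neg\Diamond\Gamma_2\Rightarrow\Diamond\Delta_1,\neg\Box\Delta_2$. ($\neg\Box$right$^t$) $\alpha,\Gamma\Rightarrow\Delta$ / $\Gamma\Rightarrow\Delta,\neg\Box\alpha$. ($\neg\Diamond$left$^t$) $\Gamma\Rightarrow\Delta,\alpha$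 / $\neg\Diamond\alpha,\Gamma\Rightarrow\Delta$. ($\neg\Diamond$right$^t$) $\alpha,\Box\Gamma_1,\neg\Diamond\Gamma_2\Rightarrow\Diamond\Delta_1,\neg\Box\Delta_2$ / $\Box\Gamma_1,\neg\Diamond\Gamma_2\Rightarrow\Diamond\Delta_1,\neg\Box\Delta_2,\neg\Diamond\alpha$. The calculus gTS4 is obtained from lTS4 by replacing ($\Box$right), ($\Diamond$left), ($\neg\Box$left$^t$), ($\neg\Diamond$right$^t$) with: ($\Box$right$^T$) $\Box\Gamma_1,\Box\Delta_2\Rightarrow\Diamond\Delta_1,\Diamond\Gamma_2,\alpha$ / $\Box\Gamma_1,\neg\Diamond\Gamma_2\Rightarrow\Diamond\Delta_1,\neg\Box\Delta_2,\Box\alpha$. ($\Diamond$left$^T$) $\alpha,\Box\Gamma_1,\Box\Delta_2\Rightarrow\Diamond\Delta_1,\Diamond\Gamma_2$ / $\Diamond\alpha,\Box\Gamma_1,\neg\Diamond\Gamma_2\Rightarrow\Diamond\Delta_1,\neg\Box\Delta_2$. ($\neg\Box$left$^T$) $\Box\Gamma_1,\Box\Delta_2\Rightarrow\Diamond\Delta_1,\Diamond\Gamma_2,\alpha$ / $\neg\Box\alpha,\Box\Gamma_1,\neg\Diamond\Gamma_2\Rightarrow\Diamond\Delta_1,\neg\Box\Delta_2$. ($\neg\Diamond$right$^T$) $\alpha,\Box\Gamma_1,\Box\Delta_2\Rightarrow\Diamond\Delta_1,\Diamond\Gamma_2$ / $\Box\Gamma_1,\neg\Diamond\Gamma_2\Rightarrow\Diamond\Delta_1,\neg\Box\Delta_2,\neg\Diamond\alpha$.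 (All other rules and initial sequents of lTS4, including ($\neg\Diamond$left$^t$), are kept.) The calculus GS4 (Kripke's calculus for S4): initial sequents $p\Rightarrow p$ for every propositional variable $p$; rules (cut), (we-left), (we-right), ($\wedge$left), ($\wedge$right), ($\vee$left), ($\vee$right), ($\to$left), ($\to$right), ($\Box$left), ($\Diamond$right) exactly as in lTS4, together with: ($\neg$left) $\Gamma\Rightarrow\Delta,\alpha$ / $\neg\alpha,\Gamma\Rightarrow\Delta$. ($\neg$right) $\alpha,\Gamma\Rightarrow\Delta$ / $\Gamma\Rightarrow\Delta,\neg\alpha$. ($\Box$right$^k$) $\Box\Gamma\Rightarrow\Diamond\Delta,\alpha$ / $\Box\Gamma\Rightarrow\Diamond\Delta,\Box\alpha$. ($\Diamond$left$^k$) $\alpha,\Box\Gamma\Rightarrow\Diamond\Delta$ / $\Diamond\alpha,\Box\Gamma\Rightarrow\Diamond\Delta$. GS4 has no twist rules and no other rules. -}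

module Defs where

open import Data.Nat using (ℕ)
open import Data.Bool using (Bool; true; false; T)
open import Data.List using (List; []; _∷_; _++_; map)
open import Data.List.Membership.Propositional using (_∈_)
open import Data.Product using (_×_)

infixr 9 _∧ᶠ_
infixr 8 _∨ᶠ_
infixr 7 _⇒ᶠ_

data Fm : Set where
  var   : ℕ → Fm
  _∧ᶠ_  : Fm → Fm → Fm
  _∨ᶠ_  : Fm → Fm → Fm
  _⇒ᶠ_  : Fm → Fm → Fm
  ¬ᶠ    : Fm → Fm
  □     : Fm → Fm
  ◇     : Fm → Fm

-- Finite sets of formulas are represented by lists, identified up to
-- having the same elements (_≋_).  A sequent Γ ⇒ Δ is a pair of lists.
_≋_ : List Fm → List Fm → Set
Γ ≋ Γ' = ∀ x → (x ∈ Γ → x ∈ Γ') × (x ∈ Γ' → x ∈ Γ)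

BL : List Fm → List Fm → List Fm
BL Γ₁ Γ₂ = map □ Γ₁ ++ map (λ a → ¬ᶠ (◇ a)) Γ₂

DR : List Fm → List Fm → List Fm
DR Δ₁ Δ₂ = map ◇ Δ₁ ++ map (λ a → ¬ᶠ (□ a)) Δ₂

data GS4 (cut? : Bool) : List Fm → List Fm → Set where
  sets   : ∀ {Γ Γ' Δ Δ'} → Γ ≋ Γ' → Δ ≋ Δ' → GS4 cut? Γ Δ → GS4 cut? Γ' Δ'
  ax     : ∀ p → GS4 cut? (var p ∷ []) (var p ∷ [])
  cut    : ∀ {Γ Δ α} → T cut? → GS4 cut? Γ (α ∷ []) → GS4 cut? (α ∷ Γ) Δ → GS4 cut? Γ Δ
  weL    : ∀ {Γ Δ} α → GS4 cut? Γ Δ → GS4 cut? (α ∷ Γ) Δ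
  weR    : ∀ {Γ Δ} α → GS4 cut? Γ Δ → GS4 cut? Γ (α ∷ Δ)
  ∧L     : ∀ {Γ Δ α β} → GS4 cut? (α ∷ β ∷ Γ) Δ → GS4 cut? (α ∧ᶠ β ∷ Γ) Δ
  ∧R     : ∀ {Γ Δ α β} → GS4 cut? Γ (α ∷ Δ) → GS4 cut? Γ (β ∷ Δ) → GS4 cut? Γ (α ∧ᶠ β ∷ Δ)
  ∨L     : ∀ {Γ Δ α β} → GS4 cut? (α ∷ Γ) Δ → GS4 cut? (β ∷ Γ) Δ → GS4 cut? (α ∨ᶠ β ∷ Γ) Δ
  ∨R     : ∀ {Γ Δ α β} → GS4 cut? Γ (α ∷ β ∷ Δ) → GS4 cut? Γ (α ∨ᶠ β ∷ Δ)
  ⇒L     : ∀ {Γ Δ α β} → GS4 cut? Γ (α ∷ Δ) → GS4 cut? (β ∷ Γ) Δ → GS4 cut? (α ⇒ᶠ β ∷ Γ) Δ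
  ⇒R     : ∀ {Γ Δ α β} → GS4 cut? (α ∷ Γ) (β ∷ Δ) → GS4 cut? Γ (α ⇒ᶠ β ∷ Δ)
  □L     : ∀ {Γ Δ α} → GS4 cut? (α ∷ Γ) Δ → GS4 cut? (□ α ∷ Γ) Δ
  ◇R     : ∀ {Γ Δ α} → GS4 cut? Γ (α ∷ Δ) → GS4 cut? Γ (◇ α ∷ Δ)
  ¬L     : ∀ {Γ Δ α} → GS4 cut? Γ (α ∷ Δ) → GS4 cut? (¬ᶠ α ∷ Γ) Δ
  ¬R     : ∀ {Γ Δ α} → GS4 cut? (α ∷ Γ) Δ → GS4 cut? Γ (¬ᶠ α ∷ Δ)
  □Rk    : ∀ Γ Δ {α} → GS4 cut? (map □ Γ) (α ∷ map ◇ Δ) → GS4 cut? (map □ Γ) (□ α ∷ map ◇ Δ)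
  ◇Lk    : ∀ Γ Δ {α} → GS4 cut? (α ∷ map □ Γ) (map ◇ Δ) → GS4 cut? (◇ α ∷ map □ Γ) (map ◇ Δ)

data Variant : Set where
  l g : Variant

data TS4 : Variant → Bool → List Fm → List Fm → Set where
  sets   : ∀ {v cut? Γ Γ' Δ Δ'} → Γ ≋ Γ' → Δ ≋ Δ' → TS4 v cut? Γ Δ → TS4 v cut? Γ' Δ'
  ax₁    : ∀ {v cut?} p → TS4 v cut? (var p ∷ []) (var p ∷ [])
  ax₂    : ∀ {v cut?} p → TS4 v cut? (¬ᶠ (var p) ∷ []) (¬ᶠ (var p) ∷ [])
  ax₃    : ∀ {v cut?} p → TS4 v cut? (¬ᶠ (var p) ∷ var p ∷ []) []
  ax₄    : ∀ {v cut?} p → TS4 v cut? [] (¬ᶠ (var p) ∷ var p ∷ [])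
  cut    : ∀ {v cut? Γ Δ α} → T cut? → TS4 v cut? Γ (α ∷ []) → TS4 v cut? (α ∷ Γ) Δ → TS4 v cut? Γ Δ
  weL    : ∀ {v cut? Γ Δ} α → TS4 v cut? Γ Δ → TS4 v cut? (α ∷ Γ) Δ
  weR    : ∀ {v cut? Γ Δ} α → TS4 v cut? Γ Δ → TS4 v cut? Γ (α ∷ Δ)
  ∧L     : ∀ {v cut? Γ Δ α β} → TS4 v cut? (α ∷ β ∷ Γ) Δ → TS4 v cut? (α ∧ᶠ β ∷ Γ) Δ
  ∧R     : ∀ {v cut? Γ Δ α β} → TS4 v cut? Γ (α ∷ Δ) → TS4 v cut? Γ (β ∷ Δ) → TS4 v cut? Γ (α ∧ᶠ β ∷ Δ)
  ∨L     : ∀ {v cut? Γ Δ α β} → TS4 v cut? (α ∷ Γ) Δ → TS4 v cut? (β ∷ Γ) Δ → TS4 v cut? (α ∨ᶠ β ∷ Γ) Δ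
  ∨R     : ∀ {v cut? Γ Δ α β} → TS4 v cut? Γ (α ∷ β ∷ Δ) → TS4 v cut? Γ (α ∨ᶠ β ∷ Δ)
  ⇒L     : ∀ {v cut? Γ Δ α β} → TS4 v cut? Γ (α ∷ Δ) → TS4 v cut? (β ∷ Γ) Δ → TS4 v cut? (α ⇒ᶠ β ∷ Γ) Δ
  ⇒R     : ∀ {v cut? Γ Δ α β} → TS4 v cut? (α ∷ Γ) (β ∷ Δ) → TS4 v cut? Γ (α ⇒ᶠ β ∷ Δ)
  □L     : ∀ {v cut? Γ Δ α} → TS4 v cut? (α ∷ Γ) Δ → TS4 v cut? (□ α ∷ Γ) Δ
  ◇R     : ∀ {v cut? Γ Δ α} → TS4 v cut? Γ (α ∷ Δ) → TS4 v cut? Γ (◇ α ∷ Δ)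
  ¬¬L    : ∀ {v cut? Γ Δ α} → TS4 v cut? (α ∷ Γ) Δ → TS4 v cut? (¬ᶠ (¬ᶠ α) ∷ Γ) Δ
  ¬¬R    : ∀ {v cut? Γ Δ α} → TS4 v cut? Γ (α ∷ Δ) → TS4 v cut? Γ (¬ᶠ (¬ᶠ α) ∷ Δ)
  ¬∧L    : ∀ {v cut? Γ Δ α β} → TS4 v cut? Γ (α ∷ Δ) → TS4 v cut? Γ (β ∷ Δ) → TS4 v cut? (¬ᶠ (α ∧ᶠ β) ∷ Γ) Δ
  ¬∧R    : ∀ {v cut? Γ Δ α β} → TS4 v cut? (α ∷ β ∷ Γ) Δ → TS4 v cut? Γ (¬ᶠ (α ∧ᶠ β) ∷ Δ)
  ¬∨L    : ∀ {v cut? Γ Δ α β} → TS4 v cut? Γ (α ∷ β ∷ Δ) → TS4 v cut? (¬ᶠ (α ∨ᶠ β) ∷ Γ) Δ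
  ¬∨R    : ∀ {v cut? Γ Δ α β} → TS4 v cut? (α ∷ Γ) Δ → TS4 v cut? (β ∷ Γ) Δ → TS4 v cut? Γ (¬ᶠ (α ∨ᶠ β) ∷ Δ)
  ¬⇒L    : ∀ {v cut? Γ Δ α β} → TS4 v cut? (α ∷ Γ) (β ∷ Δ) → TS4 v cut? (¬ᶠ (α ⇒ᶠ β) ∷ Γ) Δ
  ¬⇒R    : ∀ {v cut? Γ Δ α β} → TS4 v cut? Γ (α ∷ Δ) → TS4 v cut? (β ∷ Γ) Δ → TS4 v cut? Γ (¬ᶠ (α ⇒ᶠ β) ∷ Δ)
  ¬□R    : ∀ {v cut? Γ Δ α} → TS4 v cut? (α ∷ Γ) Δ → TS4 v cut? Γ (¬ᶠ (□ α) ∷ Δ)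
  ¬◇L    : ∀ {v cut? Γ Δ α} → TS4 v cut? Γ (α ∷ Δ) → TS4 v cut? (¬ᶠ (◇ α) ∷ Γ) Δ
  □Rˡ    : ∀ {cut?} Γ₁ Γ₂ Δ₁ Δ₂ {α} → TS4 l cut? (BL Γ₁ Γ₂) (α ∷ DR Δ₁ Δ₂)
         → TS4 l cut? (BL Γ₁ Γ₂) (□ α ∷ DR Δ₁ Δ₂)
  ◇Lˡ    : ∀ {cut?} Γ₁ Γ₂ Δ₁ Δ₂ {α} → TS4 l cut? (α ∷ BL Γ₁ Γ₂) (DR Δ₁ Δ₂)
         → TS4 l cut? (◇ α ∷ BL Γ₁ Γ₂) (DR Δ₁ Δ₂)
  ¬□Lˡ   : ∀ {cut?} Γ₁ Γ₂ Δ₁ Δ₂ {α} → TS4 l cut? (BL Γ₁ Γ₂) (α ∷ DR Δ₁ Δ₂)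
         → TS4 l cut? (¬ᶠ (□ α) ∷ BL Γ₁ Γ₂) (DR Δ₁ Δ₂)
  ¬◇Rˡ   : ∀ {cut?} Γ₁ Γ₂ Δ₁ Δ₂ {α} → TS4 l cut? (α ∷ BL Γ₁ Γ₂) (DR Δ₁ Δ₂)
         → TS4 l cut? (BL Γ₁ Γ₂) (¬ᶠ (◇ α) ∷ DR Δ₁ Δ₂)
  □Rᵍ    : ∀ {cut?} Γ₁ Γ₂ Δ₁ Δ₂ {α} → TS4 g cut? (map □ Γ₁ ++ map □ Δ₂) (α ∷ map ◇ Δ₁ ++ map ◇ Γ₂)
         → TS4 g cut? (BL Γ₁ Γ₂) (□ α ∷ DR Δ₁ Δ₂)
  ◇Lᵍ    : ∀ {cut?} Γ₁ Γ₂ Δ₁ Δ₂ {α} → TS4 g cut? (α ∷ map □ Γ₁ ++ map □ Δ₂) (map ◇ Δ₁ ++ map ◇ Γ₂)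
         → TS4 g cut? (◇ α ∷ BL Γ₁ Γ₂) (DR Δ₁ Δ₂)
  ¬□Lᵍ   : ∀ {cut?} Γ₁ Γ₂ Δ₁ Δ₂ {α} → TS4 g cut? (map □ Γ₁ ++ map □ Δ₂) (α ∷ map ◇ Δ₁ ++ map ◇ Γ₂)
         → TS4 g cut? (¬ᶠ (□ α) ∷ BL Γ₁ Γ₂) (DR Δ₁ Δ₂)
  ¬◇Rᵍ   : ∀ {cut?} Γ₁ Γ₂ Δ₁ Δ₂ {α} → TS4 g cut? (α ∷ map □ Γ₁ ++ map □ Δ₂) (map ◇ Δ₁ ++ map ◇ Γ₂)
         → TS4 g cut? (BL Γ₁ Γ₂) (¬ᶠ (◇ α) ∷ DR Δ₁ Δ₂)

-- A cut-free GS4 derivation of Γ ⇒ Δ is translated into a cut-free TS4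
-- derivation of every sequent G ⇒ D that represents Γ ⇒ Δ: each formula of Γ
-- occurs in G or, negated, in D, and each formula of Δ occurs in D or,
-- negated, in G.  The GS4 negation rules then only change the representation
-- of their principal formula, and a logical rule whose principal formula is
-- represented negated becomes the corresponding twist rule.  In the modal
-- rules the boxed context □Γ splits into the formulas represented as □γ and
-- those represented as ¬□γ (and dually for ◇Δ), which is exactly the context
-- □Γ₁, ¬◇Γ₂ ⇒ ◇Δ₁, ¬□Δ₂ of the TS4 modal rules.
module Submission where

open import Defs
open import Data.Bool using (Bool; false)
open import Data.List using (List; []; _∷_; _++_; map)
open import Data.List.Membership.Propositional using (_∈_)
open import Data.List.Membership.Propositional.Properties using (∈-map⁺; ∈-++⁺ˡ; ∈-++⁺ʳ; ∈-++⁻)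
open import Data.List.Relation.Binary.Subset.Propositional using (_⊆_)
open import Data.List.Relation.Binary.Subset.Propositional.Properties
  using (⊆-refl; ⊆-trans; xs⊆x∷xs; ∷⁺ʳ; ∈-∷⁺ʳ; ++⁺ʳ)
open import Data.List.Relation.Unary.All as All using (All; []; _∷_)
open import Data.List.Relation.Unary.All.Properties using (anti-mono; ++⁺; map⁺; map⁻)
open import Data.List.Relation.Unary.Any using (here)
open import Data.Product using (_×_; _,_; proj₁)
open import Data.Sum using (_⊎_; inj₁; inj₂; [_,_]′)
open import Function using (_∘_)
open import Relation.Binary.PropositionalEquality using (refl)

private
  variable
    v : Variant
    c : Bool
    α : Fm
    Γ Δ G D G′ D′ : List Fm

++-⊆ : ∀ {A : Set} {xs ys zs : List A} → xs ⊆ zs → ys ⊆ zs → xs ++ ys ⊆ zs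
++-⊆ {xs = xs} xs⊆zs ys⊆zs = [ xs⊆zs , ys⊆zs ]′ ∘ ∈-++⁻ xs

map-⊆ : ∀ {A B : Set} {xs : List A} {ys : List B} (f : A → B) →
        All (λ x → f x ∈ ys) xs → map f xs ⊆ ys
map-⊆ f = All.lookup ∘ map⁺

All-⊆-++ : ∀ {A : Set} {P : A → Set} {xs ys zs} → xs ⊆ ys ++ zs →
           (∀ {x} → x ∈ ys → P x) → (∀ {x} → x ∈ zs → P x) → All P xs
All-⊆-++ {ys = ys} xs⊆ys++zs p q = All.tabulate ([ p , q ]′ ∘ ∈-++⁻ ys ∘ xs⊆ys++zs)

record Partition {A : Set} (P Q : A → Set) (xs : List A) : Set where
  field
    left right : List A
    all-left   : All P left
    all-right  : All Q right
    ⊆left++right : xs ⊆ left ++ right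

partition : ∀ {A : Set} {P Q : A → Set} {xs} → All (λ x → P x ⊎ Q x) xs → Partition P Q xs
partition [] = record
  { left = [] ; right = [] ; all-left = [] ; all-right = [] ; ⊆left++right = λ () }
partition {xs = x ∷ _} (inj₁ px ∷ pqs) = record
  { left = x ∷ left ; right = right ; all-left = px ∷ all-left ; all-right = all-right
  ; ⊆left++right = ∷⁺ʳ x ⊆left++right }
  where open Partition (partition pqs)
partition {xs = x ∷ _} (inj₂ qx ∷ pqs) = record
  { left = left ; right = x ∷ right ; all-left = all-left ; all-right = qx ∷ all-right
  ; ⊆left++right = ∈-∷⁺ʳ (∈-++⁺ʳ left (here refl))
                         (⊆-trans ⊆left++right (++⁺ʳ left (xs⊆x∷xs right x))) }
  where open Partition (partition pqs)

weakenˡ-++ : ∀ G → TS4 v c Γ Δ → TS4 v c (G ++ Γ) Δ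
weakenˡ-++ []      d = d
weakenˡ-++ (α ∷ G) d = weL α (weakenˡ-++ G d)

weakenʳ-++ : ∀ D → TS4 v c Γ Δ → TS4 v c Γ (D ++ Δ)
weakenʳ-++ []      d = d
weakenʳ-++ (α ∷ D) d = weR α (weakenʳ-++ D d)

⊆⇒++≋ : Γ ⊆ G → (G ++ Γ) ≋ G
⊆⇒++≋ Γ⊆G _ = ++-⊆ ⊆-refl Γ⊆G , ∈-++⁺ˡ

weaken : Γ ⊆ G → Δ ⊆ D → TS4 v c Γ Δ → TS4 v c G D
weaken {G = G} {D = D} Γ⊆G Δ⊆D d =
  sets (⊆⇒++≋ Γ⊆G) (⊆⇒++≋ Δ⊆D) (weakenˡ-++ G (weakenʳ-++ D d))

absorbˡ : α ∈ G ⊎ ¬ᶠ α ∈ D → TS4 v c (α ∷ G) D → TS4 v c G (¬ᶠ α ∷ D) → TS4 v c G D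
absorbˡ (inj₁ α∈G)  d _ = weaken (∈-∷⁺ʳ α∈G ⊆-refl) ⊆-refl d
absorbˡ (inj₂ ¬α∈D) _ d = weaken ⊆-refl (∈-∷⁺ʳ ¬α∈D ⊆-refl) d

absorbʳ : α ∈ D ⊎ ¬ᶠ α ∈ G → TS4 v c G (α ∷ D) → TS4 v c (¬ᶠ α ∷ G) D → TS4 v c G D
absorbʳ (inj₁ α∈D)  d _ = weaken ⊆-refl (∈-∷⁺ʳ α∈D ⊆-refl) d
absorbʳ (inj₂ ¬α∈G) _ d = weaken (∈-∷⁺ʳ ¬α∈G ⊆-refl) ⊆-refl d

Represented : List Fm → List Fm → List Fm → Set
Represented Γ G D = All (λ α → α ∈ G ⊎ ¬ᶠ α ∈ D) Γ

infix 4 _⇒_↪_⇒_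

_⇒_↪_⇒_ : List Fm → List Fm → List Fm → List Fm → Set
Γ ⇒ Δ ↪ G ⇒ D = Represented Γ G D × Represented Δ D G

⊆⇒represented : Γ ⊆ G → Represented Γ G D
⊆⇒represented Γ⊆G = All.tabulate (inj₁ ∘ Γ⊆G)

represented-mono : G ⊆ G′ → D ⊆ D′ → Represented Γ G D → Represented Γ G′ D′
represented-mono G⊆G′ D⊆D′ = All.map [ inj₁ ∘ G⊆G′ , inj₂ ∘ D⊆D′ ]′

↪-extendˡ : Γ ⇒ Δ ↪ G ⇒ D → α ∷ Γ ⇒ Δ ↪ α ∷ G ⇒ D
↪-extendˡ {G = G} (Γ↪ , Δ↪) =
  inj₁ (here refl) ∷ represented-mono (xs⊆x∷xs G _) ⊆-refl Γ↪ ,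
  represented-mono ⊆-refl (xs⊆x∷xs G _) Δ↪

↪-extendʳ : Γ ⇒ Δ ↪ G ⇒ D → Γ ⇒ α ∷ Δ ↪ G ⇒ α ∷ D
↪-extendʳ {D = D} (Γ↪ , Δ↪) =
  represented-mono ⊆-refl (xs⊆x∷xs D _) Γ↪ ,
  inj₁ (here refl) ∷ represented-mono (xs⊆x∷xs D _) ⊆-refl Δ↪

modalPremiseˡ modalPremiseʳ : Variant → (Γ₁ Γ₂ Δ₁ Δ₂ : List Fm) → List Fm
modalPremiseˡ l Γ₁ Γ₂ Δ₁ Δ₂ = BL Γ₁ Γ₂
modalPremiseˡ g Γ₁ Γ₂ Δ₁ Δ₂ = map □ Γ₁ ++ map □ Δ₂
modalPremiseʳ l Γ₁ Γ₂ Δ₁ Δ₂ = DR Δ₁ Δ₂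
modalPremiseʳ g Γ₁ Γ₂ Δ₁ Δ₂ = map ◇ Δ₁ ++ map ◇ Γ₂

□R : ∀ v Γ₁ Γ₂ Δ₁ Δ₂ →
     TS4 v c (modalPremiseˡ v Γ₁ Γ₂ Δ₁ Δ₂) (α ∷ modalPremiseʳ v Γ₁ Γ₂ Δ₁ Δ₂) →
     TS4 v c (BL Γ₁ Γ₂) (□ α ∷ DR Δ₁ Δ₂)
□R l Γ₁ Γ₂ Δ₁ Δ₂ = □Rˡ Γ₁ Γ₂ Δ₁ Δ₂
□R g Γ₁ Γ₂ Δ₁ Δ₂ = □Rᵍ Γ₁ Γ₂ Δ₁ Δ₂

◇L : ∀ v Γ₁ Γ₂ Δ₁ Δ₂ →
     TS4 v c (α ∷ modalPremiseˡ v Γ₁ Γ₂ Δ₁ Δ₂) (modalPremiseʳ v Γ₁ Γ₂ Δ₁ Δ₂) →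
     TS4 v c (◇ α ∷ BL Γ₁ Γ₂) (DR Δ₁ Δ₂)
◇L l Γ₁ Γ₂ Δ₁ Δ₂ = ◇Lˡ Γ₁ Γ₂ Δ₁ Δ₂
◇L g Γ₁ Γ₂ Δ₁ Δ₂ = ◇Lᵍ Γ₁ Γ₂ Δ₁ Δ₂

¬□L : ∀ v Γ₁ Γ₂ Δ₁ Δ₂ →
      TS4 v c (modalPremiseˡ v Γ₁ Γ₂ Δ₁ Δ₂) (α ∷ modalPremiseʳ v Γ₁ Γ₂ Δ₁ Δ₂) →
      TS4 v c (¬ᶠ (□ α) ∷ BL Γ₁ Γ₂) (DR Δ₁ Δ₂)
¬□L l Γ₁ Γ₂ Δ₁ Δ₂ = ¬□Lˡ Γ₁ Γ₂ Δ₁ Δ₂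
¬□L g Γ₁ Γ₂ Δ₁ Δ₂ = ¬□Lᵍ Γ₁ Γ₂ Δ₁ Δ₂

¬◇R : ∀ v Γ₁ Γ₂ Δ₁ Δ₂ →
      TS4 v c (α ∷ modalPremiseˡ v Γ₁ Γ₂ Δ₁ Δ₂) (modalPremiseʳ v Γ₁ Γ₂ Δ₁ Δ₂) →
      TS4 v c (BL Γ₁ Γ₂) (¬ᶠ (◇ α) ∷ DR Δ₁ Δ₂)
¬◇R l Γ₁ Γ₂ Δ₁ Δ₂ = ¬◇Rˡ Γ₁ Γ₂ Δ₁ Δ₂
¬◇R g Γ₁ Γ₂ Δ₁ Δ₂ = ¬◇Rᵍ Γ₁ Γ₂ Δ₁ Δ₂

record ModalSplit (Γ Δ G D : List Fm) : Set where
  field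
    Γ₁ Γ₂ Δ₁ Δ₂ : List Fm
    BL⊆G : BL Γ₁ Γ₂ ⊆ G
    DR⊆D : DR Δ₁ Δ₂ ⊆ D
    Γ⊆Γ₁++Δ₂ : Γ ⊆ Γ₁ ++ Δ₂
    Δ⊆Δ₁++Γ₂ : Δ ⊆ Δ₁ ++ Γ₂

  premiseˡ premiseʳ : Variant → List Fm
  premiseˡ v = modalPremiseˡ v Γ₁ Γ₂ Δ₁ Δ₂
  premiseʳ v = modalPremiseʳ v Γ₁ Γ₂ Δ₁ Δ₂

  represents : ∀ v → map □ Γ ⇒ map ◇ Δ ↪ premiseˡ v ⇒ premiseʳ v
  represents l =
    map⁺ (All-⊆-++ Γ⊆Γ₁++Δ₂ (λ m → inj₁ (∈-++⁺ˡ (∈-map⁺ □ m)))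
                             (λ m → inj₂ (∈-++⁺ʳ (map ◇ Δ₁) (∈-map⁺ (¬ᶠ ∘ □) m)))) ,
    map⁺ (All-⊆-++ Δ⊆Δ₁++Γ₂ (λ m → inj₁ (∈-++⁺ˡ (∈-map⁺ ◇ m)))
                             (λ m → inj₂ (∈-++⁺ʳ (map □ Γ₁) (∈-map⁺ (¬ᶠ ∘ ◇) m))))
  represents g =
    map⁺ (All-⊆-++ Γ⊆Γ₁++Δ₂ (λ m → inj₁ (∈-++⁺ˡ (∈-map⁺ □ m)))
                             (λ m → inj₁ (∈-++⁺ʳ (map □ Γ₁) (∈-map⁺ □ m)))) ,
    map⁺ (All-⊆-++ Δ⊆Δ₁++Γ₂ (λ m → inj₁ (∈-++⁺ˡ (∈-map⁺ ◇ m)))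
                             (λ m → inj₁ (∈-++⁺ʳ (map ◇ Δ₁) (∈-map⁺ ◇ m))))

modalSplit : Represented (map □ Γ) G D → Represented (map ◇ Δ) D G → ModalSplit Γ Δ G D
modalSplit □Γ ◇Δ = record
  { Γ₁ = left boxes ; Δ₂ = right boxes ; Δ₁ = left diamonds ; Γ₂ = right diamonds
  ; BL⊆G = ++-⊆ (map-⊆ □ (all-left boxes)) (map-⊆ (¬ᶠ ∘ ◇) (all-right diamonds))
  ; DR⊆D = ++-⊆ (map-⊆ ◇ (all-left diamonds)) (map-⊆ (¬ᶠ ∘ □) (all-right boxes))
  ; Γ⊆Γ₁++Δ₂ = ⊆left++right boxes
  ; Δ⊆Δ₁++Γ₂ = ⊆left++right diamonds }
  where
  open Partition
  boxes = partition (map⁻ □Γ)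
  diamonds = partition (map⁻ ◇Δ)

translate : ∀ L → GS4 false Γ Δ → Γ ⇒ Δ ↪ G ⇒ D → TS4 L false G D
translate L (sets Γ≋ Δ≋ d) (Γ↪ , Δ↪) =
  translate L d (anti-mono (proj₁ (Γ≋ _)) Γ↪ , anti-mono (proj₁ (Δ≋ _)) Δ↪)
translate L (ax p) (inj₁ p∈G ∷ [] , inj₁ p∈D ∷ []) =
  weaken (∈-∷⁺ʳ p∈G (λ ())) (∈-∷⁺ʳ p∈D (λ ())) (ax₁ p)
translate L (ax p) (inj₁ p∈G ∷ [] , inj₂ ¬p∈G ∷ []) =
  weaken (∈-∷⁺ʳ ¬p∈G (∈-∷⁺ʳ p∈G (λ ()))) (λ ()) (ax₃ p)
translate L (ax p) (inj₂ ¬p∈D ∷ [] , inj₁ p∈D ∷ []) =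
  weaken (λ ()) (∈-∷⁺ʳ ¬p∈D (∈-∷⁺ʳ p∈D (λ ()))) (ax₄ p)
translate L (ax p) (inj₂ ¬p∈D ∷ [] , inj₂ ¬p∈G ∷ []) =
  weaken (∈-∷⁺ʳ ¬p∈G (λ ())) (∈-∷⁺ʳ ¬p∈D (λ ())) (ax₂ p)
translate L (cut () _ _) _
translate L (weL _ d) (_ ∷ Γ↪ , Δ↪) = translate L d (Γ↪ , Δ↪)
translate L (weR _ d) (Γ↪ , _ ∷ Δ↪) = translate L d (Γ↪ , Δ↪)
translate L (∧L d) (φ ∷ Γ↪ , Δ↪) = absorbˡ φ (∧L d′) (¬∧R d′)
  where d′ = translate L d (↪-extendˡ (↪-extendˡ (Γ↪ , Δ↪)))
translate L (∧R d e) (Γ↪ , φ ∷ Δ↪) = absorbʳ φ (∧R d′ e′) (¬∧L d′ e′)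
  where d′ = translate L d (↪-extendʳ (Γ↪ , Δ↪))
        e′ = translate L e (↪-extendʳ (Γ↪ , Δ↪))
translate L (∨L d e) (φ ∷ Γ↪ , Δ↪) = absorbˡ φ (∨L d′ e′) (¬∨R d′ e′)
  where d′ = translate L d (↪-extendˡ (Γ↪ , Δ↪))
        e′ = translate L e (↪-extendˡ (Γ↪ , Δ↪))
translate L (∨R d) (Γ↪ , φ ∷ Δ↪) = absorbʳ φ (∨R d′) (¬∨L d′)
  where d′ = translate L d (↪-extendʳ (↪-extendʳ (Γ↪ , Δ↪)))
translate L (⇒L d e) (φ ∷ Γ↪ , Δ↪) = absorbˡ φ (⇒L d′ e′) (¬⇒R d′ e′)
  where d′ = translate L d (↪-extendʳ (Γ↪ , Δ↪))
        e′ = translate L e (↪-extendˡ (Γ↪ , Δ↪))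
translate L (⇒R d) (Γ↪ , φ ∷ Δ↪) = absorbʳ φ (⇒R d′) (¬⇒L d′)
  where d′ = translate L d (↪-extendˡ (↪-extendʳ (Γ↪ , Δ↪)))
translate L (□L d) (φ ∷ Γ↪ , Δ↪) = absorbˡ φ (□L d′) (¬□R d′)
  where d′ = translate L d (↪-extendˡ (Γ↪ , Δ↪))
translate L (◇R d) (Γ↪ , φ ∷ Δ↪) = absorbʳ φ (◇R d′) (¬◇L d′)
  where d′ = translate L d (↪-extendʳ (Γ↪ , Δ↪))
translate L (¬L d) (inj₁ ¬α∈G ∷ Γ↪ , Δ↪) = translate L d (Γ↪ , inj₂ ¬α∈G ∷ Δ↪)
translate L (¬L d) (inj₂ ¬¬α∈D ∷ Γ↪ , Δ↪) =
  weaken ⊆-refl (∈-∷⁺ʳ ¬¬α∈D ⊆-refl) (¬¬R (translate L d (↪-extendʳ (Γ↪ , Δ↪))))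
translate L (¬R d) (Γ↪ , inj₁ ¬α∈D ∷ Δ↪) = translate L d (inj₂ ¬α∈D ∷ Γ↪ , Δ↪)
translate L (¬R d) (Γ↪ , inj₂ ¬¬α∈G ∷ Δ↪) =
  weaken (∈-∷⁺ʳ ¬¬α∈G ⊆-refl) ⊆-refl (¬¬L (translate L d (↪-extendˡ (Γ↪ , Δ↪))))
translate L (□Rk Γ Δ d) (□Γ , φ ∷ ◇Δ) =
  absorbʳ φ (weaken BL⊆G (∷⁺ʳ _ DR⊆D) (□R L Γ₁ Γ₂ Δ₁ Δ₂ d′))
            (weaken (∷⁺ʳ _ BL⊆G) DR⊆D (¬□L L Γ₁ Γ₂ Δ₁ Δ₂ d′))
  where
  open ModalSplit (modalSplit □Γ ◇Δ)
  d′ = translate L d (↪-extendʳ (represents L))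
translate L (◇Lk Γ Δ d) (φ ∷ □Γ , ◇Δ) =
  absorbˡ φ (weaken (∷⁺ʳ _ BL⊆G) DR⊆D (◇L L Γ₁ Γ₂ Δ₁ Δ₂ d′))
            (weaken BL⊆G (∷⁺ʳ _ DR⊆D) (¬◇R L Γ₁ Γ₂ Δ₁ Δ₂ d′))
  where
  open ModalSplit (modalSplit □Γ ◇Δ)
  d′ = translate L d (↪-extendˡ (represents L))

lemma4p3 : (L : Variant) (Γ Δ : List Fm) → GS4 false Γ Δ → TS4 L false Γ Δ
lemma4p3 L Γ Δ d = translate L d (⊆⇒represented ⊆-refl , ⊆⇒represented ⊆-refl)
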